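{- For $l\in\mathbb{Z}_{\ge0}$ let $Q_l(t)=\sum_{h=0}^l h!\binom{l}{h}^2(-t)^h$ and let $P_l(t)$ be the polynomial obtained by truncating the formal power series $Q_l(t)\sum_{k=0}^\infty k!t^k$ to its terms of degree at most $l-1$. Then the determinant $$\begin{vmatrix}Q_l(t)&P_l(t)\\ Q_{l+1}(t)&P_{l+1}(t)\end{vmatrix}$$ is non-zero (as a polynomial in $t$). -}

module Defs where

open import Data.Nat as ℕ using (ℕ; zero; suc; _∸_; _≤?_; _<?_; _!)
open import Data.Nat.Combinatorics using (_C_)
open import Data.Integer using (ℤ; +_; -1ℤ; _+_; _-_; _*_; _^_)
open import Data.Product using (∃)
open import Relation.Binary.PropositionalEquality using (_≢_)
open import Relation.Nullary.Decidable using (does)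
open import Data.Bool using (if_then_else_)

-- Polynomials / formal power series over ℤ, represented by their
-- coefficient sequence (coefficient of t^n at index n).
Series : Set
Series = ℕ → ℤ

sumTo : ℕ → (ℕ → ℤ) → ℤ
sumTo zero    f = f 0
sumTo (suc n) f = sumTo n f + f (suc n)

_⊛_ : Series → Series → Series
(f ⊛ g) n = sumTo n (λ i → f i * g (n ∸ i))

_⊖_ : Series → Series → Series
(f ⊖ g) n = f n - g n

truncBelow : ℕ → Series → Series
truncBelow d f n = if does (n <? d) then f n else + 0

NonZeroSeries : Series → Set
NonZeroSeries f = ∃ λ n → f n ≢ + 0

Q : ℕ → Series
Q l h = if does (h ≤? l) then (-1ℤ ^ h) * + ((h !) ℕ.* ((l C h) ℕ.* (l C h))) else + 0

factSeries : Series
factSeries k = + (k !)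

P : ℕ → Series
P l = truncBelow l (Q l ⊛ factSeries)

detQP : ℕ → Series
detQP l = (Q l ⊛ P (suc l)) ⊖ (Q (suc l) ⊛ P l)

-- Let P∞_l = Q_l · Σ k! t^k, so that P_l is its truncation below degree l.  Since
-- h! (l choose h)² (l+k-h)! = l! (l choose h) (l-h+1)⋯(l-h+k), the coefficient of t^(l+k) in
-- P∞_l is l! times the l-th finite difference at 0 of the degree-k polynomial n ↦ (n+1)⋯(n+k).
-- Hence P∞_l has no terms of degree l, …, 2l-1, and its coefficient of t^(2l) is (l!)².  So
-- P_(l+1) agrees with P∞_(l+1) up to degree 2l, and P∞_l - P_l starts at degree 2l.  Up to
-- degree 2l the determinant is therefore Q_l P∞_(l+1) - Q_(l+1) P_l = Q_(l+1) (P∞_l - P_l),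
-- whose coefficient of t^(2l) is (l!)² ≠ 0.
module Submission where

open import Defs
open import Data.Nat as ℕ using (ℕ; zero; suc; _∸_; _≤_; _<_; z≤n; s≤s; _!; _≤?_; _<?_)
import Data.Nat.Properties as ℕ
open import Data.Nat.Combinatorics
  using (_C_; nCk≡n!/k![n-k]!; k![n∸k]!∣n!; nCk+nC[k+1]≡[n+1]C[k+1]; k>n⇒nCk≡0)
open import Data.Nat.DivMod using (m*[n/m]≡n)
open import Data.Integer using (ℤ; +_; -1ℤ; _+_; _-_; _*_; _^_)
import Data.Integer.Properties as ℤ
open import Data.Integer.Tactic.RingSolver using (solve-∀)
import Data.Nat.Tactic.RingSolver as ℕ-Solver
open import Data.Product using (_,_)
open import Data.Sum using (inj₁; inj₂)
open import Relation.Binary.PropositionalEquality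
open import Relation.Nullary.Decidable using (does; yes; no; dec-true; dec-false)
open import Data.Bool using (if_then_else_)
open import Algebra.Properties.CommutativeSemigroup ℕ.*-commutativeSemigroup using (x∙yz≈y∙xz)

open ≡-Reasoning

sumTo-cong : ∀ n {f g : ℕ → ℤ} → (∀ i → i ≤ n → f i ≡ g i) → sumTo n f ≡ sumTo n g
sumTo-cong zero    f≗g = f≗g 0 z≤n
sumTo-cong (suc n) f≗g =
  cong₂ _+_ (sumTo-cong n (λ i i≤n → f≗g i (ℕ.m≤n⇒m≤1+n i≤n))) (f≗g (suc n) ℕ.≤-refl)

sumTo-+ : ∀ n f g → sumTo n (λ i → f i + g i) ≡ sumTo n f + sumTo n g
sumTo-+ zero    f g = refl
sumTo-+ (suc n) f g = begin
  sumTo n (λ i → f i + g i) + (f (suc n) + g (suc n))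
    ≡⟨ cong (_+ (f (suc n) + g (suc n))) (sumTo-+ n f g) ⟩
  (sumTo n f + sumTo n g) + (f (suc n) + g (suc n))
    ≡⟨ interchange (sumTo n f) (sumTo n g) (f (suc n)) (g (suc n)) ⟩
  (sumTo n f + f (suc n)) + (sumTo n g + g (suc n)) ∎
  where
  interchange : ∀ a b c d → (a + b) + (c + d) ≡ (a + c) + (b + d)
  interchange = solve-∀

sumTo-*ˡ : ∀ n c f → sumTo n (λ i → c * f i) ≡ c * sumTo n f
sumTo-*ˡ zero    c f = refl
sumTo-*ˡ (suc n) c f =
  trans (cong (_+ c * f (suc n)) (sumTo-*ˡ n c f)) (sym (ℤ.*-distribˡ-+ c (sumTo n f) (f (suc n))))

sumTo-- : ∀ n f g → sumTo n (λ i → f i - g i) ≡ sumTo n f - sumTo n g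
sumTo-- n f g = begin
  sumTo n (λ i → f i - g i)
    ≡⟨ sumTo-cong n (λ i _ → cong (_+_ (f i)) (sym (ℤ.-1*i≡-i (g i)))) ⟩
  sumTo n (λ i → f i + -1ℤ * g i)      ≡⟨ sumTo-+ n f _ ⟩
  sumTo n f + sumTo n (λ i → -1ℤ * g i) ≡⟨ cong (_+_ (sumTo n f)) (sumTo-*ˡ n -1ℤ g) ⟩
  sumTo n f + -1ℤ * sumTo n g          ≡⟨ cong (_+_ (sumTo n f)) (ℤ.-1*i≡-i (sumTo n g)) ⟩
  sumTo n f - sumTo n g                ∎

sumTo-truncate : ∀ {m} n f → m ≤ n → (∀ i → m < i → i ≤ n → f i ≡ + 0) →
                 sumTo n f ≡ sumTo m f
sumTo-truncate zero    f z≤n _ = refl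
sumTo-truncate {m} (suc n) f m≤1+n f≡0 with ℕ.m≤n⇒m<n∨m≡n m≤1+n
... | inj₂ refl      = refl
... | inj₁ (s≤s m≤n) = begin
  sumTo n f + f (suc n)
    ≡⟨ cong₂ _+_ (sumTo-truncate n f m≤n (λ i m<i i≤n → f≡0 i m<i (ℕ.m≤n⇒m≤1+n i≤n)))
                 (f≡0 (suc n) (s≤s m≤n) ℕ.≤-refl) ⟩
  sumTo m f + + 0        ≡⟨ ℤ.+-identityʳ _ ⟩
  sumTo m f              ∎

sumTo-sucˡ : ∀ n f → sumTo (suc n) f ≡ f 0 + sumTo n (λ i → f (suc i))
sumTo-sucˡ zero    f = refl
sumTo-sucˡ (suc n) f =
  trans (cong (_+ f (suc (suc n))) (sumTo-sucˡ n f))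
        (ℤ.+-assoc (f 0) (sumTo n (λ i → f (suc i))) (f (suc (suc n))))

sumTo-comm : ∀ m n (f : ℕ → ℕ → ℤ) →
             sumTo m (λ i → sumTo n (f i)) ≡ sumTo n (λ j → sumTo m (λ i → f i j))
sumTo-comm zero    n f = refl
sumTo-comm (suc m) n f =
  trans (cong (_+ sumTo n (f (suc m))) (sumTo-comm m n f))
        (sym (sumTo-+ n (λ j → sumTo m (λ i → f i j)) (f (suc m))))

⊛-congʳ : ∀ f {g h} n → (∀ m → m ≤ n → g m ≡ h m) → (f ⊛ g) n ≡ (f ⊛ h) n
⊛-congʳ f n g≗h = sumTo-cong n (λ i _ → cong (f i *_) (g≗h (n ∸ i) (ℕ.m∸n≤m n i)))

⊛-distribˡ-⊖ : ∀ f g h n → (f ⊛ (g ⊖ h)) n ≡ ((f ⊛ g) ⊖ (f ⊛ h)) n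
⊛-distribˡ-⊖ f g h n = begin
  sumTo n (λ i → f i * (g (n ∸ i) - h (n ∸ i)))
    ≡⟨ sumTo-cong n (λ i _ → *-distribˡ-- (f i) (g (n ∸ i)) (h (n ∸ i))) ⟩
  sumTo n (λ i → f i * g (n ∸ i) - f i * h (n ∸ i))
    ≡⟨ sumTo-- n _ _ ⟩
  (f ⊛ g) n - (f ⊛ h) n ∎
  where
  *-distribˡ-- : ∀ a b c → a * (b - c) ≡ a * b - a * c
  *-distribˡ-- = solve-∀

⊛-headˡ : ∀ f g n → (∀ m → m < n → g m ≡ + 0) → (f ⊛ g) n ≡ f 0 * g n
⊛-headˡ f g n g≡0 = sumTo-truncate n _ z≤n
  (λ i 0<i i≤n → trans (cong (f i *_) (g≡0 (n ∸ i) (ℕ.∸-monoʳ-< 0<i i≤n)))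
                       (ℤ.*-zeroʳ (f i)))

-- a ⊛ (b ⊛ c) at n as a double sum over the square [0, n]², with the terms outside
-- the triangle i + j ≤ n set to 0; this sum is symmetric in a and b.
tripleTerm : Series → Series → Series → ℕ → ℕ → ℕ → ℤ
tripleTerm a b c n i j = if does (i ℕ.+ j ≤? n) then a i * (b j * c (n ∸ i ∸ j)) else + 0

⊛-⊛-square : ∀ a b c n → (a ⊛ (b ⊛ c)) n ≡ sumTo n (λ i → sumTo n (tripleTerm a b c n i))
⊛-⊛-square a b c n = sumTo-cong n row
  where
  row : ∀ i → i ≤ n →
        a i * sumTo (n ∸ i) (λ j → b j * c (n ∸ i ∸ j)) ≡ sumTo n (tripleTerm a b c n i)
  row i i≤n = begin
    a i * sumTo (n ∸ i) (λ j → b j * c (n ∸ i ∸ j))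
      ≡⟨ sumTo-*ˡ (n ∸ i) (a i) _ ⟨
    sumTo (n ∸ i) (λ j → a i * (b j * c (n ∸ i ∸ j)))
      ≡⟨ sumTo-cong (n ∸ i) inside ⟩
    sumTo (n ∸ i) (tripleTerm a b c n i)
      ≡⟨ sumTo-truncate n _ (ℕ.m∸n≤m n i) outside ⟨
    sumTo n (tripleTerm a b c n i) ∎
    where
    inside : ∀ j → j ≤ n ∸ i → a i * (b j * c (n ∸ i ∸ j)) ≡ tripleTerm a b c n i j
    inside j j≤n∸i rewrite dec-true (i ℕ.+ j ≤? n)
      (subst (i ℕ.+ j ≤_) (ℕ.m+[n∸m]≡n i≤n) (ℕ.+-monoʳ-≤ i j≤n∸i)) = refl
    outside : ∀ j → n ∸ i < j → j ≤ n → tripleTerm a b c n i j ≡ + 0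
    outside j n∸i<j _ rewrite dec-false (i ℕ.+ j ≤? n)
      (λ i+j≤n → ℕ.<⇒≱ n∸i<j (subst (_≤ n ∸ i) (ℕ.m+n∸m≡n i j) (ℕ.∸-monoˡ-≤ i i+j≤n)))
      = refl

tripleTerm-swap : ∀ a b c n i j → tripleTerm a b c n i j ≡ tripleTerm b a c n j i
tripleTerm-swap a b c n i j rewrite ℕ.+-comm i j =
  cong (λ x → if does (j ℕ.+ i ≤? n) then x else + 0) (begin
    a i * (b j * c (n ∸ i ∸ j)) ≡⟨ cong (λ m → a i * (b j * c m)) (∸-swap n i j) ⟩
    a i * (b j * c (n ∸ j ∸ i)) ≡⟨ *-swap (a i) (b j) _ ⟩
    b j * (a i * c (n ∸ j ∸ i)) ∎)
  where
  ∸-swap : ∀ n i j → n ∸ i ∸ j ≡ n ∸ j ∸ i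
  ∸-swap n i j =
    trans (ℕ.∸-+-assoc n i j) (trans (cong (n ∸_) (ℕ.+-comm i j)) (sym (ℕ.∸-+-assoc n j i)))
  *-swap : ∀ x y z → x * (y * z) ≡ y * (x * z)
  *-swap = solve-∀

⊛-swap : ∀ a b c n → (a ⊛ (b ⊛ c)) n ≡ (b ⊛ (a ⊛ c)) n
⊛-swap a b c n = begin
  (a ⊛ (b ⊛ c)) n                                      ≡⟨ ⊛-⊛-square a b c n ⟩
  sumTo n (λ i → sumTo n (tripleTerm a b c n i))       ≡⟨ sumTo-comm n n (tripleTerm a b c n) ⟩
  sumTo n (λ j → sumTo n (λ i → tripleTerm a b c n i j))
    ≡⟨ sumTo-cong n (λ j _ → sumTo-cong n (λ i _ → tripleTerm-swap a b c n i j)) ⟩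
  sumTo n (λ j → sumTo n (tripleTerm b a c n j))       ≡⟨ ⊛-⊛-square b a c n ⟨
  (b ⊛ (a ⊛ c)) n                                      ∎

truncBelow-< : ∀ {d n} f → n < d → truncBelow d f n ≡ f n
truncBelow-< {d} {n} f n<d rewrite dec-true (n <? d) n<d = refl

truncBelow-≥ : ∀ {d n} f → d ≤ n → truncBelow d f n ≡ + 0
truncBelow-≥ {d} {n} f d≤n rewrite dec-false (n <? d) (ℕ.≤⇒≯ d≤n) = refl

rise : ℕ → ℕ → ℕ
rise m zero    = 1
rise m (suc k) = suc (m ℕ.+ k) ℕ.* rise m k

!-rise : ∀ m k → (m ℕ.+ k) ! ≡ m ! ℕ.* rise m k
!-rise m zero    rewrite ℕ.+-identityʳ m = sym (ℕ.*-identityʳ (m !))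
!-rise m (suc k) rewrite ℕ.+-suc m k =
  trans (cong (suc (m ℕ.+ k) ℕ.*_) (!-rise m k)) (x∙yz≈y∙xz (suc (m ℕ.+ k)) (m !) (rise m k))

rise-sucʳ : ∀ m k → rise m (suc k) ≡ suc m ℕ.* rise (suc m) k
rise-sucʳ m zero    rewrite ℕ.+-identityʳ m = refl
rise-sucʳ m (suc k) = begin
  suc (m ℕ.+ suc k) ℕ.* (suc (m ℕ.+ k) ℕ.* rise m k)
    ≡⟨ cong (suc (m ℕ.+ suc k) ℕ.*_) (rise-sucʳ m k) ⟩
  suc (m ℕ.+ suc k) ℕ.* (suc m ℕ.* rise (suc m) k)
    ≡⟨ x∙yz≈y∙xz (suc (m ℕ.+ suc k)) (suc m) (rise (suc m) k) ⟩
  suc m ℕ.* (suc (m ℕ.+ suc k) ℕ.* rise (suc m) k)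
    ≡⟨ cong (λ x → suc m ℕ.* (suc x ℕ.* rise (suc m) k)) (ℕ.+-suc m k) ⟩
  suc m ℕ.* rise (suc m) (suc k) ∎

rise-difference : ∀ m k → rise (suc m) (suc k) ≡ rise m (suc k) ℕ.+ suc k ℕ.* rise (suc m) k
rise-difference m k = begin
  suc (suc m ℕ.+ k) ℕ.* rise (suc m) k
    ≡⟨ cong (ℕ._* rise (suc m) k) (ℕ.+-suc (suc m) k) ⟨
  (suc m ℕ.+ suc k) ℕ.* rise (suc m) k
    ≡⟨ ℕ.*-distribʳ-+ (rise (suc m) k) (suc m) (suc k) ⟩
  suc m ℕ.* rise (suc m) k ℕ.+ suc k ℕ.* rise (suc m) k
    ≡⟨ cong (ℕ._+ suc k ℕ.* rise (suc m) k) (rise-sucʳ m k) ⟨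
  rise m (suc k) ℕ.+ suc k ℕ.* rise (suc m) k ∎

-- Δ l f is the l-th forward difference of f at 0, expanded by the binomial theorem.
Δ : ℕ → (ℕ → ℤ) → ℤ
Δ l f = sumTo l (λ h → (-1ℤ ^ h) * (+ (l C h) * f (l ∸ h)))

Δ-zero : ∀ f → Δ 0 f ≡ f 0
Δ-zero f = trans (ℤ.*-identityˡ _) (ℤ.*-identityˡ (f 0))

Δ-cong : ∀ l {f g} → (∀ n → f n ≡ g n) → Δ l f ≡ Δ l g
Δ-cong l f≗g = sumTo-cong l (λ h _ → cong (λ x → (-1ℤ ^ h) * (+ (l C h) * x)) (f≗g (l ∸ h)))

Δ-*ˡ : ∀ l c f → Δ l (λ n → c * f n) ≡ c * Δ l f
Δ-*ˡ l c f =
  trans (sumTo-cong l (λ h _ → pull (-1ℤ ^ h) (+ (l C h)) c (f (l ∸ h)))) (sumTo-*ˡ l c _)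
  where
  pull : ∀ s b c x → s * (b * (c * x)) ≡ c * (s * (b * x))
  pull = solve-∀

Δ-- : ∀ l f g → Δ l (λ n → f n - g n) ≡ Δ l f - Δ l g
Δ-- l f g =
  trans (sumTo-cong l (λ h _ → expand (-1ℤ ^ h) (+ (l C h)) (f (l ∸ h)) (g (l ∸ h))))
        (sumTo-- l _ _)
  where
  expand : ∀ s b x y → s * (b * (x - y)) ≡ s * (b * x) - s * (b * y)
  expand = solve-∀

-- Pascal's rule splits the binomial expansion of Δ (suc l) f into those of Δ l (f ∘ suc) and Δ l f.
Δ-suc : ∀ l f → Δ (suc l) f ≡ Δ l (λ n → f (suc n)) - Δ l f
Δ-suc l f = begin
  Δ (suc l) f                          ≡⟨ sumTo-cong (suc l) (λ h _ → pascal h) ⟩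
  sumTo (suc l) (λ h → u h + w h)      ≡⟨ sumTo-+ (suc l) u w ⟩
  sumTo (suc l) u + sumTo (suc l) w    ≡⟨ cong₂ _+_ u-sum w-sum ⟩
  Δ l (λ n → f (suc n)) + -1ℤ * Δ l f
    ≡⟨ cong (_+_ (Δ l (λ n → f (suc n)))) (ℤ.-1*i≡-i (Δ l f)) ⟩
  Δ l (λ n → f (suc n)) - Δ l f        ∎
  where
  term u w : ℕ → ℤ
  term h = (-1ℤ ^ h) * (+ (l C h) * f (l ∸ h))
  u h = (-1ℤ ^ h) * (+ (l C h) * f (suc l ∸ h))
  w zero    = + 0
  w (suc h) = -1ℤ * term h

  expand : ∀ s a b x → (-1ℤ * s) * ((a + b) * x) ≡ (-1ℤ * s) * (b * x) + -1ℤ * (s * (a * x))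
  expand = solve-∀

  pascal : ∀ h → (-1ℤ ^ h) * (+ (suc l C h) * f (suc l ∸ h)) ≡ u h + w h
  pascal zero    = sym (ℤ.+-identityʳ _)
  pascal (suc h) = begin
    (-1ℤ * (-1ℤ ^ h)) * (+ (suc l C suc h) * f (l ∸ h))
      ≡⟨ cong (λ c → (-1ℤ * (-1ℤ ^ h)) * (+ c * f (l ∸ h))) (nCk+nC[k+1]≡[n+1]C[k+1] l h) ⟨
    (-1ℤ * (-1ℤ ^ h)) * (+ (l C h ℕ.+ l C suc h) * f (l ∸ h))
      ≡⟨ cong (λ c → (-1ℤ * (-1ℤ ^ h)) * (c * f (l ∸ h))) (ℤ.pos-+ (l C h) (l C suc h)) ⟩
    (-1ℤ * (-1ℤ ^ h)) * ((+ (l C h) + + (l C suc h)) * f (l ∸ h))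
      ≡⟨ expand (-1ℤ ^ h) (+ (l C h)) (+ (l C suc h)) (f (l ∸ h)) ⟩
    u (suc h) + w (suc h) ∎

  u-sum : sumTo (suc l) u ≡ Δ l (λ n → f (suc n))
  u-sum = begin
    sumTo (suc l) u ≡⟨ sumTo-truncate (suc l) u (ℕ.n≤1+n l) u-beyond ⟩
    sumTo l u
      ≡⟨ sumTo-cong l (λ h h≤l → cong (λ m → (-1ℤ ^ h) * (+ (l C h) * f m)) (ℕ.+-∸-assoc 1 h≤l)) ⟩
    Δ l (λ n → f (suc n)) ∎
    where
    u-beyond : ∀ h → l < h → h ≤ suc l → u h ≡ + 0
    u-beyond h l<h _ rewrite k>n⇒nCk≡0 l<h =
      trans (cong ((-1ℤ ^ h) *_) (ℤ.*-zeroˡ (f (suc l ∸ h)))) (ℤ.*-zeroʳ (-1ℤ ^ h))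

  w-sum : sumTo (suc l) w ≡ -1ℤ * Δ l f
  w-sum = trans (sumTo-sucˡ l w) (trans (ℤ.+-identityˡ _) (sumTo-*ˡ l -1ℤ term))

risingSeq : ℕ → ℕ → ℕ → ℤ
risingSeq s k n = + rise (s ℕ.+ n) k

risingSeq-difference : ∀ s k n →
  risingSeq s (suc k) (suc n) - risingSeq s (suc k) n ≡ + suc k * risingSeq (suc s) k n
risingSeq-difference s k n = begin
  + rise (s ℕ.+ suc n) (suc k) - + rise (s ℕ.+ n) (suc k)
    ≡⟨ cong (λ x → + rise x (suc k) - + rise (s ℕ.+ n) (suc k)) (ℕ.+-suc s n) ⟩
  + rise (suc (s ℕ.+ n)) (suc k) - + rise (s ℕ.+ n) (suc k)
    ≡⟨ cong (λ x → + x - + rise (s ℕ.+ n) (suc k)) (rise-difference (s ℕ.+ n) k) ⟩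
  + (rise (s ℕ.+ n) (suc k) ℕ.+ suc k ℕ.* rise (suc s ℕ.+ n) k) - + rise (s ℕ.+ n) (suc k)
    ≡⟨ cong (_- + rise (s ℕ.+ n) (suc k)) (ℤ.pos-+ (rise (s ℕ.+ n) (suc k)) _) ⟩
  (+ rise (s ℕ.+ n) (suc k) + + (suc k ℕ.* rise (suc s ℕ.+ n) k)) - + rise (s ℕ.+ n) (suc k)
    ≡⟨ cancel (+ rise (s ℕ.+ n) (suc k)) _ ⟩
  + (suc k ℕ.* rise (suc s ℕ.+ n) k)
    ≡⟨ ℤ.pos-* (suc k) _ ⟩
  + suc k * risingSeq (suc s) k n ∎
  where
  cancel : ∀ a b → (a + b) - a ≡ b
  cancel = solve-∀

Δ-risingSeq-suc : ∀ l s k → Δ (suc l) (risingSeq s (suc k)) ≡ + suc k * Δ l (risingSeq (suc s) k)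
Δ-risingSeq-suc l s k = begin
  Δ (suc l) (risingSeq s (suc k))
    ≡⟨ Δ-suc l (risingSeq s (suc k)) ⟩
  Δ l (λ n → risingSeq s (suc k) (suc n)) - Δ l (risingSeq s (suc k))
    ≡⟨ Δ-- l (λ n → risingSeq s (suc k) (suc n)) (risingSeq s (suc k)) ⟨
  Δ l (λ n → risingSeq s (suc k) (suc n) - risingSeq s (suc k) n)
    ≡⟨ Δ-cong l (risingSeq-difference s k) ⟩
  Δ l (λ n → + suc k * risingSeq (suc s) k n)
    ≡⟨ Δ-*ˡ l (+ suc k) (risingSeq (suc s) k) ⟩
  + suc k * Δ l (risingSeq (suc s) k) ∎

Δ-risingSeq-< : ∀ {k l} s → k < l → Δ l (risingSeq s k) ≡ + 0
Δ-risingSeq-< {zero}  {suc l} s _ = trans (Δ-suc l (risingSeq s 0)) (ℤ.+-inverseʳ (Δ l (risingSeq s 0)))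
Δ-risingSeq-< {suc k} {suc l} s (s≤s k<l) = begin
  Δ (suc l) (risingSeq s (suc k))     ≡⟨ Δ-risingSeq-suc l s k ⟩
  + suc k * Δ l (risingSeq (suc s) k) ≡⟨ cong (+ suc k *_) (Δ-risingSeq-< (suc s) k<l) ⟩
  + suc k * + 0                       ≡⟨ ℤ.*-zeroʳ (+ suc k) ⟩
  + 0                                 ∎

Δ-risingSeq-top : ∀ l s → Δ l (risingSeq s l) ≡ + (l !)
Δ-risingSeq-top zero    s = Δ-zero (risingSeq s 0)
Δ-risingSeq-top (suc l) s = begin
  Δ (suc l) (risingSeq s (suc l))     ≡⟨ Δ-risingSeq-suc l s l ⟩
  + suc l * Δ l (risingSeq (suc s) l) ≡⟨ cong (+ suc l *_) (Δ-risingSeq-top l (suc s)) ⟩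
  + suc l * + (l !)                   ≡⟨ ℤ.pos-* (suc l) (l !) ⟨
  + (suc l !)                         ∎

P∞ : ℕ → Series
P∞ l = Q l ⊛ factSeries

Q-≤ : ∀ {l h} → h ≤ l → Q l h ≡ (-1ℤ ^ h) * + (h ! ℕ.* ((l C h) ℕ.* (l C h)))
Q-≤ {l} {h} h≤l rewrite dec-true (h ≤? l) h≤l = refl

Q-> : ∀ {l h} → l < h → Q l h ≡ + 0
Q-> {l} {h} l<h rewrite dec-false (h ≤? l) (ℕ.<⇒≱ l<h) = refl

k!*[n∸k]!*nCk≡n! : ∀ {n k} → k ≤ n → k ! ℕ.* (n ∸ k) ! ℕ.* (n C k) ≡ n !
k!*[n∸k]!*nCk≡n! {n} {k} k≤n =
  trans (cong (k ! ℕ.* (n ∸ k) ! ℕ.*_) (nCk≡n!/k![n-k]! k≤n))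
        (m*[n/m]≡n {{ℕ._!*_!≢0 k (n ∸ k)}} (k![n∸k]!∣n! k≤n))

Q-coeff*factorial : ∀ {l h} k → h ≤ l →
  h ! ℕ.* ((l C h) ℕ.* (l C h)) ℕ.* (l ℕ.+ k ∸ h) ! ≡ l ! ℕ.* ((l C h) ℕ.* rise (l ∸ h) k)
Q-coeff*factorial {l} {h} k h≤l = begin
  h ! ℕ.* ((l C h) ℕ.* (l C h)) ℕ.* (l ℕ.+ k ∸ h) !
    ≡⟨ cong (λ x → h ! ℕ.* ((l C h) ℕ.* (l C h)) ℕ.* x !) (ℕ.+-∸-comm k h≤l) ⟩
  h ! ℕ.* ((l C h) ℕ.* (l C h)) ℕ.* (l ∸ h ℕ.+ k) !
    ≡⟨ cong (h ! ℕ.* ((l C h) ℕ.* (l C h)) ℕ.*_) (!-rise (l ∸ h) k) ⟩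
  h ! ℕ.* ((l C h) ℕ.* (l C h)) ℕ.* ((l ∸ h) ! ℕ.* rise (l ∸ h) k)
    ≡⟨ regroup (h !) (l C h) ((l ∸ h) !) (rise (l ∸ h) k) ⟩
  h ! ℕ.* (l ∸ h) ! ℕ.* (l C h) ℕ.* ((l C h) ℕ.* rise (l ∸ h) k)
    ≡⟨ cong (ℕ._* ((l C h) ℕ.* rise (l ∸ h) k)) (k!*[n∸k]!*nCk≡n! h≤l) ⟩
  l ! ℕ.* ((l C h) ℕ.* rise (l ∸ h) k) ∎
  where
  regroup : ∀ a c b r → a ℕ.* (c ℕ.* c) ℕ.* (b ℕ.* r) ≡ a ℕ.* b ℕ.* c ℕ.* (c ℕ.* r)
  regroup = ℕ-Solver.solve-∀

P∞-coeff : ∀ l k → P∞ l (l ℕ.+ k) ≡ + (l !) * Δ l (risingSeq 0 k)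
P∞-coeff l k = begin
  sumTo (l ℕ.+ k) (λ h → Q l h * + ((l ℕ.+ k ∸ h) !))
    ≡⟨ sumTo-truncate (l ℕ.+ k) _ (ℕ.m≤m+n l k)
                      (λ h l<h _ → cong (_* + ((l ℕ.+ k ∸ h) !)) (Q-> l<h)) ⟩
  sumTo l (λ h → Q l h * + ((l ℕ.+ k ∸ h) !))
    ≡⟨ sumTo-cong l term ⟩
  sumTo l (λ h → + (l !) * ((-1ℤ ^ h) * (+ (l C h) * risingSeq 0 k (l ∸ h))))
    ≡⟨ sumTo-*ˡ l (+ (l !)) _ ⟩
  + (l !) * Δ l (risingSeq 0 k) ∎
  where
  swap : ∀ s c x → s * (c * x) ≡ c * (s * x)
  swap = solve-∀
  term : ∀ h → h ≤ l → Q l h * + ((l ℕ.+ k ∸ h) !) ≡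
                       + (l !) * ((-1ℤ ^ h) * (+ (l C h) * risingSeq 0 k (l ∸ h)))
  term h h≤l = begin
    Q l h * + ((l ℕ.+ k ∸ h) !)
      ≡⟨ cong (_* + ((l ℕ.+ k ∸ h) !)) (Q-≤ h≤l) ⟩
    (-1ℤ ^ h) * + (h ! ℕ.* ((l C h) ℕ.* (l C h))) * + ((l ℕ.+ k ∸ h) !)
      ≡⟨ ℤ.*-assoc (-1ℤ ^ h) _ _ ⟩
    (-1ℤ ^ h) * (+ (h ! ℕ.* ((l C h) ℕ.* (l C h))) * + ((l ℕ.+ k ∸ h) !))
      ≡⟨ cong ((-1ℤ ^ h) *_) (ℤ.pos-* (h ! ℕ.* ((l C h) ℕ.* (l C h))) _) ⟨
    (-1ℤ ^ h) * + (h ! ℕ.* ((l C h) ℕ.* (l C h)) ℕ.* (l ℕ.+ k ∸ h) !)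
      ≡⟨ cong (λ x → (-1ℤ ^ h) * + x) (Q-coeff*factorial k h≤l) ⟩
    (-1ℤ ^ h) * + (l ! ℕ.* ((l C h) ℕ.* rise (l ∸ h) k))
      ≡⟨ cong ((-1ℤ ^ h) *_) (trans (ℤ.pos-* (l !) _) (cong (+ (l !) *_) (ℤ.pos-* (l C h) _))) ⟩
    (-1ℤ ^ h) * (+ (l !) * (+ (l C h) * + rise (l ∸ h) k))
      ≡⟨ swap (-1ℤ ^ h) (+ (l !)) _ ⟩
    + (l !) * ((-1ℤ ^ h) * (+ (l C h) * + rise (l ∸ h) k)) ∎

P∞-gap : ∀ {l m} → l ≤ m → m < l ℕ.+ l → P∞ l m ≡ + 0
P∞-gap {l} {m} l≤m m<2l = begin
  P∞ l m                            ≡⟨ cong (P∞ l) (ℕ.m+[n∸m]≡n l≤m) ⟨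
  P∞ l (l ℕ.+ (m ∸ l))              ≡⟨ P∞-coeff l (m ∸ l) ⟩
  + (l !) * Δ l (risingSeq 0 (m ∸ l)) ≡⟨ cong (+ (l !) *_) (Δ-risingSeq-< 0 m∸l<l) ⟩
  + (l !) * + 0                     ≡⟨ ℤ.*-zeroʳ (+ (l !)) ⟩
  + 0                               ∎
  where
  m∸l<l : m ∸ l < l
  m∸l<l = ℕ.+-cancelˡ-< l (m ∸ l) l (subst (_< l ℕ.+ l) (sym (ℕ.m+[n∸m]≡n l≤m)) m<2l)

P∞-top : ∀ l → P∞ l (l ℕ.+ l) ≡ + (l ! ℕ.* l !)
P∞-top l = begin
  P∞ l (l ℕ.+ l)                ≡⟨ P∞-coeff l l ⟩
  + (l !) * Δ l (risingSeq 0 l) ≡⟨ cong (+ (l !) *_) (Δ-risingSeq-top l 0) ⟩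
  + (l !) * + (l !)             ≡⟨ ℤ.pos-* (l !) (l !) ⟨
  + (l ! ℕ.* l !)               ∎

P-suc-agrees : ∀ l {m} → m ≤ l ℕ.+ l → P (suc l) m ≡ P∞ (suc l) m
P-suc-agrees l {m} m≤2l with m <? suc l
... | yes m<1+l = truncBelow-< (P∞ (suc l)) m<1+l
... | no  m≮1+l = trans (truncBelow-≥ (P∞ (suc l)) 1+l≤m) (sym (P∞-gap 1+l≤m m<2[1+l]))
  where
  1+l≤m : suc l ≤ m
  1+l≤m = ℕ.≮⇒≥ m≮1+l
  m<2[1+l] : m < suc l ℕ.+ suc l
  m<2[1+l] = s≤s (ℕ.≤-trans m≤2l (ℕ.+-monoʳ-≤ l (ℕ.n≤1+n l)))

P∞⊖P-below : ∀ {l m} → m < l ℕ.+ l → (P∞ l ⊖ P l) m ≡ + 0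
P∞⊖P-below {l} {m} m<2l with m <? l
... | yes m<l = trans (cong (P∞ l m -_) (truncBelow-< (P∞ l) m<l)) (ℤ.+-inverseʳ (P∞ l m))
... | no  m≮l = cong₂ _-_ (P∞-gap (ℕ.≮⇒≥ m≮l) m<2l) (truncBelow-≥ (P∞ l) (ℕ.≮⇒≥ m≮l))

detQP-top : ∀ l → detQP l (l ℕ.+ l) ≡ + (l ! ℕ.* l !)
detQP-top l = begin
  (Q l ⊛ P (suc l)) N - (Q (suc l) ⊛ P l) N
    ≡⟨ cong (_- (Q (suc l) ⊛ P l) N) (⊛-congʳ (Q l) N (λ _ → P-suc-agrees l)) ⟩
  (Q l ⊛ P∞ (suc l)) N - (Q (suc l) ⊛ P l) N
    ≡⟨ cong (_- (Q (suc l) ⊛ P l) N) (⊛-swap (Q l) (Q (suc l)) factSeries N) ⟩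
  (Q (suc l) ⊛ P∞ l) N - (Q (suc l) ⊛ P l) N
    ≡⟨ ⊛-distribˡ-⊖ (Q (suc l)) (P∞ l) (P l) N ⟨
  (Q (suc l) ⊛ (P∞ l ⊖ P l)) N
    ≡⟨ ⊛-headˡ (Q (suc l)) (P∞ l ⊖ P l) N (λ m m<N → P∞⊖P-below m<N) ⟩
  Q (suc l) 0 * (P∞ l N - P l N)
    ≡⟨ ℤ.*-identityˡ (P∞ l N - P l N) ⟩
  P∞ l N - P l N
    ≡⟨ cong₂ _-_ (P∞-top l) (truncBelow-≥ (P∞ l) (ℕ.m≤m+n l l)) ⟩
  + (l ! ℕ.* l !) - + 0
    ≡⟨ ℤ.+-identityʳ _ ⟩
  + (l ! ℕ.* l !) ∎
  where
  N = l ℕ.+ l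

lemma7p1 : (l : ℕ) → NonZeroSeries (detQP l)
lemma7p1 l = l ℕ.+ l , λ det≡0 →
  ℕ.≢-nonZero⁻¹ (l ! ℕ.* l !) {{ℕ.m*n≢0 (l !) (l !)}} (ℤ.+-injective (trans (sym (detQP-top l)) det≡0))
  where instance
  l!≢0 = l ℕ.!≢0
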